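{- Let $(S,\circ,BB)$ be an Assembly Space and let $\mathscr{O}\in S$ be Binary Decomposable, with $s(\mathscr{O})=2^{n_1}+\cdots+2^{n_H}$, $n_1>\cdots>n_H\ge0$, $H=H(s(\mathscr{O}))$. Define \[ G(\mathscr{O})=(H-1)+\sum_{i=1}^{n_1}\min\Big\{\sum_{j=1}^{H}\big\lfloor 2^{\,n_j-i}\big\rfloor,\ \mathrm{Card}\big(S(2^i)\big)\Big\},\qquad Ma_{BD}(\mathscr{O})=\min\{s(\mathscr{O})-1,\ G(\mathscr{O})\}. \] Then \[ a(\mathscr{O})\;\le\; Ma_{BD}(\mathscr{O})\;\le\; s(\mathscr{O})-1. \]
   Context: A Multi-Magma $(S,\circ)$ is a set $S$ together with a binary operation $\circ:2^S\times 2^S\to 2^S$, extended element-wise: for $A,A'\subseteq S$, $A\circ A'=\bigcup_{x\in A,\,y\in A'}\{x\}\circ\{y\}$. A subset $BB\subseteq S$ is fixed as the set of Building Blocks. Assembly Addition Chains: for $\mathscr{O}\in S\setminus BB$, an AAC of $\mathscr{O}$ is a finite sequence $(\mathscr{O}_1,\dots,\mathscr{O}_r)$ of elements of $S$ with $\mathscr{O}_r=\mathscr{O}$, $\mathscr{O}_1\in\{\mathscr{B}\}\circ\{\mathscr{B}'\}$ for some $\mathscr{B},\mathscr{B}'\in BB$, and for each $\rho\in\{2,\dots,r\}$ there exist $\mathscr{O}_\sigma,\mathscr{O}_\tau\in\{\mathscr{O}_1,\dots,\mathscr{O}_{\rho-1}\}\cup BB$ with $\mathscr{O}_\rho\in\{\mathscr{O}_\sigma\}\circ\{\mathscr{O}_\tau\}$.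 Its length is $r$. Assembly Multi-Magma: for every $\mathscr{O}\in S\setminus BB$: (1) there exist $\mathscr{B}_0,\dots,\mathscr{B}_r\in BB$ and an AAC $\Gamma(\mathscr{O})=(\mathscr{O}_1,\dots,\mathscr{O}_r=\mathscr{O})$ with $\mathscr{O}_1\in\{\mathscr{B}_0\}\circ\{\mathscr{B}_1\}$, $\mathscr{O}_i\in\{\mathscr{O}_{i-1}\}\circ\{\mathscr{B}_i\}$ ($i\ge 2$); (2) any other such chain from blocks $\overline{\mathscr{B}}_0,\dots,\overline{\mathscr{B}}_s$ has $s=r$ and the blocks are a permutation of the $\mathscr{B}_i$. Size: $s(\mathscr{O})=1$ for $\mathscr{O}\in BB$, $s(\mathscr{O})=r+1$ otherwise. Assembly Space: additionally $s(\mathscr{O})=s(\mathscr{O}_\sigma)+s(\mathscr{O}_\tau)$ whenever $\mathscr{O}\in S\setminus BB$ and $\mathscr{O}\in\{\mathscr{O}_\sigma\}\circ\{\mathscr{O}_\tau\}$. Assembly Index: $a(\mathscr{O})=0$ for $\mathscr{O}\in BB$, otherwise the minimal length of an AAC of $\mathscr{O}$. $S(k)=\{\mathscr{O}\in S: s(\mathscr{O})=k\}$, $\mathrm{Card}$ denotes cardinality, and $H(k)$ is the Hamming weight of $k$. Balanced products: $T(\mathscr{B}_1)=\{\mathscr{B}_1\}$ and $T(\mathscr{B}_1,\dots,\mathscr{B}_{2^m})=T(\mathscr{B}_1,\dots,\mathscr{B}_{2^{m-1}})\circ T(\mathscr{B}_{2^{m-1}+1},\dots,\mathscr{B}_{2^m})$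 for $\mathscr{B}_j\in BB$. Binary Decomposable objects: $\mathscr{O}$ with $s(\mathscr{O})=2^{n_1}+\cdots+2^{n_H}$ ($n_1>\cdots>n_H\ge0$) is Binary Decomposable if there exist $\mathscr{B}^{(i)}_j\in BB$ ($i=1,\dots,H$, $j=1,\dots,2^{n_i}$) and $\mathscr{P}_i\in T(\mathscr{B}^{(i)}_1,\dots,\mathscr{B}^{(i)}_{2^{n_i}})$ with $\mathscr{O}\in\{\mathscr{P}_H\}\circ\big(\cdots\circ(\{\mathscr{P}_3\}\circ(\{\mathscr{P}_2\}\circ\{\mathscr{P}_1\}))\cdots\big)$ (for $H=1$: $\mathscr{O}=\mathscr{P}_1$). -}

module Defs where

open import Level using (0ℓ)
open import Data.Nat using (ℕ; zero; suc; _+_; _∸_; _^_; _≤_; _⊓_; _≤?_)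
open import Data.List using (List; []; _∷_; length; map)
open import Data.Nat.ListAction using (sum)
open import Data.List.Membership.Propositional using (_∈_)
open import Data.List.Relation.Binary.Permutation.Propositional using (_↭_)
open import Data.Maybe using (Maybe; just; nothing)
open import Data.Fin using (Fin)
open import Data.Product using (Σ; ∃; _×_; _,_)
open import Data.Sum using (_⊎_)
open import Function.Bundles using (_↔_)
open import Relation.Nullary using (¬_; yes; no)
open import Relation.Binary.PropositionalEquality using (_≡_)

-- Notions relative to a multi-magma given as a relation
--   op x y z  means  z ∈ {x} ∘ {y}
-- and a predicate BB of building blocks.

module Chains (S : Set) (op : S → S → S → Set) (BB : S → Set) where

  -- Linear chains of condition (1): O₁ ∈ {B₀}∘{B₁}, Oᵢ ∈ {Oᵢ₋₁}∘{Bᵢ}.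
  -- LinChain o bs : o is the last element of such a chain whose block
  -- list (B₀,…,B_r, stored most recent first) is bs; length bs = r+1.
  data LinChain : S → List S → Set where
    start : ∀ {b₀ b₁ o} → BB b₀ → BB b₁ → op b₀ b₁ o → LinChain o (b₁ ∷ b₀ ∷ [])
    step  : ∀ {o bs b o'} → LinChain o bs → BB b → op o b o' → LinChain o' (b ∷ bs)

  Avail : List S → S → Set
  Avail prev x = BB x ⊎ x ∈ prev

  -- Valid AAC prefixes (stored most recent element first).
  data Chain : List S → Set where
    []   : Chain []
    cons : ∀ {prev x y o} → Chain prev → Avail prev x → Avail prev y →
           op x y o → Chain (o ∷ prev)

  AAC : S → ℕ → Set
  AAC o r = Σ (List S) λ prev → Chain (o ∷ prev) × suc (length prev) ≡ r

  -- Balanced products: Bal m P  iff  P ∈ T(B₁,…,B_{2^m}) for some blocks Bⱼ.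
  data Bal : ℕ → S → Set where
    leaf : ∀ {b} → BB b → Bal zero b
    node : ∀ {m x y z} → Bal m x → Bal m y → op x y z → Bal (suc m) z

  -- Nested product { P_H } ∘ ( ⋯ ∘ ({P₂} ∘ {P₁}) ⋯ ), exponent list read n₂,…,n_H,
  -- with accumulated predicate A describing the inner product.
  NestFrom : (S → Set) → List ℕ → S → Set
  NestFrom A []       o = A o
  NestFrom A (n ∷ ns) o = NestFrom (λ z → Σ S λ p → Σ S λ q → Bal n p × A q × op p q z) ns o

  BinDecWith : ℕ → List ℕ → S → Set
  BinDecWith n₁ ns o = NestFrom (Bal n₁) ns o

record AssemblySpace : Set₁ where
  field
    Carrier : Set
    op      : Carrier → Carrier → Carrier → Set
    BB      : Carrier → Set
  open Chains Carrier op BB public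
  field
    chain-exists : ∀ o → ¬ BB o → Σ (List Carrier) λ bs → LinChain o bs
    chain-perm   : ∀ o {bs bs'} → ¬ BB o → LinChain o bs → LinChain o bs' → bs ↭ bs'
    size         : Carrier → ℕ
    size-BB      : ∀ o → BB o → size o ≡ 1
    size-chain   : ∀ o {bs} → ¬ BB o → LinChain o bs → size o ≡ length bs
    size-add     : ∀ o x y → ¬ BB o → op x y o → size o ≡ size x + size y

module _ (A : AssemblySpace) where
  open AssemblySpace A

  IsAssemblyIndex : Carrier → ℕ → Set
  IsAssemblyIndex o k =
    (BB o × k ≡ 0) ⊎ (¬ BB o × AAC o k × (∀ r → AAC o r → k ≤ r))

  SizeClass : ℕ → Set
  SizeClass k = Σ Carrier λ x → size x ≡ k

  -- Card(S(k)) = c, where nothing stands for an infinite cardinality.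
  CardIs : ℕ → Maybe ℕ → Set
  CardIs k (just c) = Fin c ↔ SizeClass k
  CardIs k nothing  = ∀ c → ¬ (Fin c ↔ SizeClass k)

-- ⌊ 2^(n - i) ⌋ for naturals n, i (0 when i > n)
floorPow2 : ℕ → ℕ → ℕ
floorPow2 n i with i ≤? n
... | yes _ = 2 ^ (n ∸ i)
... | no  _ = 0

minCard : ℕ → Maybe ℕ → ℕ
minCard x nothing  = x
minCard x (just c) = x ⊓ c

sum1to : (ℕ → ℕ) → ℕ → ℕ
sum1to f zero    = 0
sum1to f (suc n) = sum1to f n + f (suc n)

-- G(O) for exponent list ns = n₁ ∷ … (n₁ the largest), cardinalities card i = Card(S(2^i))
G : List ℕ → (ℕ → Maybe ℕ) → ℕ
G []        card = 0
G (n₁ ∷ ns) card =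
  (length (n₁ ∷ ns) ∸ 1) +
  sum1to (λ i → minCard (sum (map (λ nj → floorPow2 nj i) (n₁ ∷ ns))) (card i)) n₁

{-# OPTIONS --safe #-}
module Submission where

-- Write O as a forest of balanced products of heights n₁ > ⋯ > n_H, joined by H − 1 further
-- products. As sizes are subadditive and a balanced product of height n has size at most 2ⁿ,
-- s(O) = Σ 2^{nⱼ} forces every node of height i of the forest to have size exactly 2ⁱ.
-- An AAC is then built height by height: each node of height i is a product of two nodes of
-- height i − 1 (those of height 0 are building blocks), and the Σⱼ ⌊2^{nⱼ−i}⌋ nodes of height i,
-- all lying in S(2ⁱ), take at most min{Σⱼ ⌊2^{nⱼ−i}⌋, Card(S(2ⁱ))} steps once repetitions are
-- dropped. The H − 1 outer products finish the chain, so a(O) ≤ G(O); the linear chain of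
-- condition (1) gives a(O) ≤ s(O) − 1.

open import Defs
open import Data.Nat using (ℕ; _∸_; _^_; _≤_; _>_; _⊓_)
open import Data.List using (List; _∷_; map)
open import Data.Nat.ListAction using (sum)
open import Data.List.Relation.Unary.Linked using (Linked)
open import Data.Maybe using (Maybe)
open import Data.Product using (Σ; _×_)
open import Data.Sum using (_⊎_)
open import Relation.Binary.PropositionalEquality using (_≡_)

open import Data.Nat using (zero; suc; _+_; _<_; z≤n; s≤s; s≤s⁻¹)
open import Data.Nat.Properties
open import Algebra.Properties.CommutativeSemigroup +-commutativeSemigroup using (x∙yz≈y∙xz)
open import Data.List using ([]; _++_; length; lookup; deduplicate)
open import Data.List.Properties using (length-++; length-map; length-deduplicate)
open import Relation.Binary.Definitions using (DecidableEquality)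
open import Data.List.Membership.Propositional using (_∈_)
open import Data.List.Membership.Propositional.Properties
  using (∈-++⁻; ∈-lookup; ∈-deduplicate⁻; ∈-deduplicate⁺)
open import Data.List.Relation.Binary.Subset.Propositional using (_⊆_)
open import Data.List.Relation.Binary.Subset.Propositional.Properties
  using (⊆-refl; map⁺; xs⊆xs++ys; xs⊆ys++xs)
open import Data.List.Relation.Unary.Any using (here; there)
open import Data.List.Relation.Unary.All as All using (All; []; _∷_)
open import Data.List.Relation.Unary.AllPairs using (_∷_)
open import Data.List.Relation.Unary.Linked.Properties using (Linked⇒AllPairs)
open import Data.List.Relation.Unary.Unique.Propositional using (Unique)
open import Data.List.Relation.Unary.Unique.DecPropositional.Properties using (deduplicate-!)
open import Data.Maybe using (just; nothing)
open import Data.Fin using (Fin) renaming (zero to fzero; suc to fsuc)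
open import Data.Fin.Properties using (injective⇒≤; inj⇒≟)
open import Data.Product using (_,_; proj₁; proj₂; map₂)
open import Data.Sum using (inj₁; inj₂)
import Data.Sum as Sum
open import Function using (_∘_; id; flip)
open import Function.Bundles using (_↣_; Injection)
open import Function.Properties.Inverse using (↔-sym; ↔⇒↣)
open import Relation.Nullary using (¬_; Dec; yes; no; contradiction)
open import Relation.Nullary.Decidable using (decidable-stable)
open import Relation.Binary.PropositionalEquality
  using (refl; sym; trans; cong; cong₂; subst; module ≡-Reasoning)

Unique-lookup-injective : ∀ {a} {X : Set a} {xs : List X} → Unique xs →
                          ∀ i j → lookup xs i ≡ lookup xs j → i ≡ j
Unique-lookup-injective (_ ∷ _)    fzero    fzero    _  = refl
Unique-lookup-injective (x≢ ∷ _)   fzero    (fsuc j) eq = contradiction eq (All.lookup x≢ (∈-lookup j))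
Unique-lookup-injective (x≢ ∷ _)   (fsuc i) fzero    eq = contradiction (sym eq) (All.lookup x≢ (∈-lookup i))
Unique-lookup-injective (_ ∷ uniq) (fsuc i) (fsuc j) eq = cong fsuc (Unique-lookup-injective uniq i j eq)

Unique⇒length≤ : ∀ {a} {X : Set a} {c} → X ↣ Fin c → {xs : List X} → Unique xs → length xs ≤ c
Unique⇒length≤ f {xs} uniq =
  injective⇒≤ {f = Injection.to f ∘ lookup xs}
    (λ {i} {j} eq → Unique-lookup-injective uniq i j (Injection.injective f eq))

map-proj₁-toList : ∀ {a p} {X : Set a} {P : X → Set p} {xs : List X} (pxs : All P xs) →
                   map proj₁ (All.toList pxs) ≡ xs
map-proj₁-toList []         = refl
map-proj₁-toList (_ ∷ pxs) = cong (_ ∷_) (map-proj₁-toList pxs)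

+-squeeze : ∀ {x y a b} → x ≤ a → y ≤ b → a + b ≤ x + y → x ≡ a × y ≡ b
+-squeeze {x} {y} {a} {b} x≤a y≤b a+b≤x+y =
  ≤-antisym x≤a (+-cancelʳ-≤ b a x (≤-trans a+b≤x+y (+-monoʳ-≤ x y≤b))) ,
  ≤-antisym y≤b (+-cancelˡ-≤ a b y (≤-trans a+b≤x+y (+-monoˡ-≤ y x≤a)))

2^n+2^n≡2^[1+n] : ∀ n → 2 ^ n + 2 ^ n ≡ 2 ^ suc n
2^n+2^n≡2^[1+n] n = cong (2 ^ n +_) (sym (+-identityʳ (2 ^ n)))

linked>⇒All≤ : ∀ {n ns} → Linked _>_ (n ∷ ns) → All (_≤ n) ns
linked>⇒All≤ ordered with Linked⇒AllPairs (λ b<a c<b → <-trans c<b b<a) ordered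
... | n>ns ∷ _ = All.map <⇒≤ n>ns

module _ (A : AssemblySpace) where
  open AssemblySpace A

  AACWithin : Carrier → ℕ → Set
  AACWithin o m = Σ ℕ λ r → AAC o r × r ≤ m

  ProductOf : (Carrier → Set) → Carrier → Set
  ProductOf P z = Σ Carrier λ x → Σ Carrier λ y → P x × P y × op x y z

  ProductOf-mono : ∀ {P Q : Carrier → Set} → (∀ {x} → P x → Q x) →
                   ∀ {z} → ProductOf P z → ProductOf Q z
  ProductOf-mono f (x , y , px , py , xy↦z) = x , y , f px , f py , xy↦z

  Avail-mono : ∀ {C C′} → C ⊆ C′ → ∀ {z} → Avail C z → Avail C′ z
  Avail-mono C⊆C′ = Sum.map₂ C⊆C′

  ¬BB⇒size≢0 : ∀ {x} → ¬ BB x → ¬ size x ≡ 0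
  ¬BB⇒size≢0 {x} ¬bb with chain-exists x ¬bb
  ... | _ ∷ _ , c = λ size≡0 → 1+n≢0 (trans (sym (size-chain x ¬bb c)) size≡0)

  size>0 : ∀ x → size x > 0
  size>0 x = n≢0⇒n>0 λ size≡0 → ¬BB⇒size≢0 (λ bb → 1+n≢0 (trans (sym (size-BB x bb)) size≡0)) size≡0

  -- size-add only covers z ∉ BB, and BB is not decidable; the goal being decidable, the case
  -- split on BB z can be made under a double negation.
  size-subadditive : ∀ {x y z} → op x y z → size z ≤ size x + size y
  size-subadditive {x} {y} {z} xy↦z = decidable-stable (size z ≤? size x + size y) λ size≰ →
    size≰ (≤-reflexive (size-add z x y (size≰ ∘ BB⇒size≤) xy↦z))
    where
      BB⇒size≤ : BB z → size z ≤ size x + size y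
      BB⇒size≤ bb = subst (_≤ size x + size y) (sym (size-BB z bb)) (≤-trans (size>0 x) (m≤m+n _ _))

  size≥2⇒¬BB : ∀ {x} → 2 ≤ size x → ¬ BB x
  size≥2⇒¬BB {x} 2≤size bb = <-irrefl refl (subst (2 ≤_) (size-BB x bb) 2≤size)

  LinChain⇒AAC : ∀ {o b bs} → LinChain o (b ∷ bs) → AAC o (length bs)
  LinChain⇒AAC (start b₀ b₁ b₀b₁↦o) = [] , cons [] (inj₁ b₀) (inj₁ b₁) b₀b₁↦o , refl
  LinChain⇒AAC (step {bs = _ ∷ _} c b xb↦o) with LinChain⇒AAC c
  ... | prev , ch , len = _ ∷ prev , cons ch (inj₂ (here refl)) (inj₁ b) xb↦o , cong suc len

  ¬BB⇒AAC-size : ∀ {o} → ¬ BB o → AAC o (size o ∸ 1)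
  ¬BB⇒AAC-size {o} ¬bb with chain-exists o ¬bb
  ... | _ ∷ bs , c = subst (AAC o) (cong (_∸ 1) (sym (size-chain o ¬bb c))) (LinChain⇒AAC c)

  Chain-∈⇒AACWithin : ∀ {o C} → o ∈ C → Chain C → AACWithin o (length C)
  Chain-∈⇒AACWithin (here refl) ch                = _ , (_ , ch , refl) , ≤-refl
  Chain-∈⇒AACWithin (there o∈C) (cons ch _ _ _) = map₂ (map₂ m≤n⇒m≤1+n) (Chain-∈⇒AACWithin o∈C ch)

  AACWithin-mono : ∀ {o m n} → m ≤ n → AACWithin o m → AACWithin o n
  AACWithin-mono m≤n = map₂ (map₂ (λ r≤m → ≤-trans r≤m m≤n))

  AACWithin-⊓ : ∀ {o m n} → AACWithin o m → AACWithin o n → AACWithin o (m ⊓ n)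
  AACWithin-⊓ (r , aac-r , r≤m) (s , aac-s , s≤n) with ≤-total r s
  ... | inj₁ r≤s = r , aac-r , ⊓-glb r≤m (≤-trans r≤s s≤n)
  ... | inj₂ s≤r = s , aac-s , ⊓-glb (≤-trans s≤r r≤m) s≤n

  Chain-++ : ∀ {C} → Chain C → (xs : List Carrier) → (∀ {z} → z ∈ xs → ProductOf (Avail C) z) →
             Chain (xs ++ C)
  Chain-++ ch []       _        = ch
  Chain-++ {C} ch (x ∷ xs) products with products (here refl)
  ... | a , b , a-av , b-av , ab↦x =
    cons (Chain-++ ch xs (products ∘ there)) (Avail-mono (xs⊆ys++xs C xs) a-av)
         (Avail-mono (xs⊆ys++xs C xs) b-av) ab↦x

  record Layered (L : ℕ → List Carrier) : Set where
    field
      ground-BB : ∀ {z} → z ∈ L 0 → BB z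
      built     : ∀ i {z} → z ∈ L (suc i) → ProductOf (_∈ L i) z
  open Layered

  Layered-[] : Layered (λ _ → [])
  Layered-[] = record { ground-BB = λ () ; built = λ _ () }

  Layered-++ : ∀ {L L′} → Layered L → Layered L′ → Layered (λ i → L i ++ L′ i)
  Layered-++ {L} {L′} layered layered′ = record
    { ground-BB = Sum.[ ground-BB layered , ground-BB layered′ ] ∘ ∈-++⁻ (L 0)
    ; built     = λ i → Sum.[ ProductOf-mono (xs⊆xs++ys (L i) (L′ i)) ∘ built layered i
                        , ProductOf-mono (xs⊆ys++xs (L′ i) (L i)) ∘ built layered′ i
                        ] ∘ ∈-++⁻ (L (suc i))
    }

  Graded : (ℕ → List Carrier) → Set
  Graded L = ∀ i {z} → z ∈ L i → size z ≡ 2 ^ i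

  Graded-++ : ∀ {L L′} → Graded L → Graded L′ → Graded (λ i → L i ++ L′ i)
  Graded-++ {L} graded graded′ i = Sum.[ graded i , graded′ i ] ∘ ∈-++⁻ (L i)

  Representatives : List Carrier → ℕ → Set
  Representatives xs n = Σ (List Carrier) λ ys → ys ⊆ xs × xs ⊆ ys × length ys ≤ n

  layeredChain : ∀ {L} → Layered L → (b : ℕ → ℕ) → (∀ i → Representatives (L i) (b i)) → ∀ n →
    Σ (List Carrier) λ C → Chain C × (∀ {i} → i ≤ n → ∀ {z} → z ∈ L i → Avail C z)
                         × length C ≤ sum1to b n
  layeredChain layered b reps zero =
    [] , [] , (λ { z≤n → inj₁ ∘ ground-BB layered }) , z≤n
  layeredChain {L} layered b reps (suc n) with layeredChain layered b reps n | reps (suc n)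
  ... | C , ch , avail , C-len | ys , ys⊆ , ⊆ys , ys-len =
    ys ++ C ,
    Chain-++ ch ys (ProductOf-mono (avail ≤-refl) ∘ built layered n ∘ ys⊆) ,
    avail′ ,
    (begin
      length (ys ++ C)         ≡⟨ length-++ ys ⟩
      length ys + length C     ≤⟨ +-mono-≤ ys-len C-len ⟩
      b (suc n) + sum1to b n   ≡⟨ +-comm (b (suc n)) _ ⟩
      sum1to b (suc n)         ∎)
    where
      open ≤-Reasoning
      avail′ : ∀ {i} → i ≤ suc n → ∀ {z} → z ∈ L i → Avail (ys ++ C) z
      avail′ i≤1+n with m≤n⇒m<n∨m≡n i≤1+n
      ... | inj₁ i<1+n = Avail-mono (xs⊆ys++xs C ys) ∘ avail (s≤s⁻¹ i<1+n)
      ... | inj₂ refl  = inj₂ ∘ xs⊆xs++ys ys C ∘ ⊆ys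

  Bal-size-≤ : ∀ {m p} → Bal m p → size p ≤ 2 ^ m
  Bal-size-≤ (leaf bb) = ≤-reflexive (size-BB _ bb)
  Bal-size-≤ (node {m} l r xy↦z) = begin
    size _                ≤⟨ size-subadditive xy↦z ⟩
    size _ + size _       ≤⟨ +-mono-≤ (Bal-size-≤ l) (Bal-size-≤ r) ⟩
    2 ^ m + 2 ^ m         ≡⟨ 2^n+2^n≡2^[1+n] m ⟩
    2 ^ suc m             ∎
    where open ≤-Reasoning

  atDepth : ∀ {m p} → Bal m p → ℕ → List Carrier
  atDepth {p = p} _ zero    = p ∷ []
  atDepth (leaf _)     (suc d) = []
  atDepth (node l r _) (suc d) = atDepth l d ++ atDepth r d

  length-atDepth : ∀ {m p} (t : Bal m p) {d} → d ≤ m → length (atDepth t d) ≡ 2 ^ d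
  length-atDepth t            {zero}  _         = refl
  length-atDepth (node l r _) {suc d} (s≤s d≤m) = begin
    length (atDepth l d ++ atDepth r d)          ≡⟨ length-++ (atDepth l d) ⟩
    length (atDepth l d) + length (atDepth r d)
      ≡⟨ cong₂ _+_ (length-atDepth l d≤m) (length-atDepth r d≤m) ⟩
    2 ^ d + 2 ^ d                                ≡⟨ 2^n+2^n≡2^[1+n] d ⟩
    2 ^ suc d                                    ∎
    where open ≡-Reasoning

  atDepth-BB : ∀ {m p} (t : Bal m p) {z} → z ∈ atDepth t m → BB z
  atDepth-BB (leaf bb)        (here refl) = bb
  atDepth-BB (node {m} l r _) z∈          =
    Sum.[ atDepth-BB l , atDepth-BB r ] (∈-++⁻ (atDepth l m) z∈)

  atDepth-built : ∀ {m p} (t : Bal m p) {d} → d < m → ∀ {z} → z ∈ atDepth t d →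
                  ProductOf (_∈ atDepth t (suc d)) z
  atDepth-built (node {x = x} {y = y} l r xy↦z) {zero} _ (here refl) =
    x , y , here refl , there (here refl) , xy↦z
  atDepth-built (node l r _) {suc d} (s≤s d<m) z∈ =
    Sum.[ ProductOf-mono (xs⊆xs++ys _ _) ∘ atDepth-built l d<m
        , ProductOf-mono (xs⊆ys++xs _ _) ∘ atDepth-built r d<m
        ] (∈-++⁻ (atDepth l d) z∈)

  atDepth-size : ∀ {m p} (t : Bal m p) → size p ≡ 2 ^ m →
                 ∀ {d z} → z ∈ atDepth t d → size z ≡ 2 ^ (m ∸ d)
  atDepth-size t            p-tight {zero}  (here refl) = p-tight
  atDepth-size (node {m} {x} {y} l r xy↦z) z-tight {suc d} z∈ =
    Sum.[ atDepth-size l (proj₁ children-tight) {d} , atDepth-size r (proj₂ children-tight) {d} ]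
      (∈-++⁻ (atDepth l d) z∈)
    where
      open ≤-Reasoning
      children-tight : size x ≡ 2 ^ m × size y ≡ 2 ^ m
      children-tight = +-squeeze (Bal-size-≤ l) (Bal-size-≤ r) (begin
        2 ^ m + 2 ^ m         ≡⟨ 2^n+2^n≡2^[1+n] m ⟩
        2 ^ suc m             ≡⟨ sym z-tight ⟩
        size _                ≤⟨ size-subadditive xy↦z ⟩
        size x + size y       ∎)

  atHeight : ∀ {m p} → Bal m p → ℕ → List Carrier
  atHeight {m} t i with i ≤? m
  ... | yes _ = atDepth t (m ∸ i)
  ... | no  _ = []

  length-atHeight : ∀ {m p} (t : Bal m p) i → length (atHeight t i) ≡ floorPow2 m i
  length-atHeight {m} t i with i ≤? m
  ... | yes _ = length-atDepth t (m∸n≤m m i)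
  ... | no  _ = refl

  root∈atHeight : ∀ {m p} (t : Bal m p) → p ∈ atHeight t m
  root∈atHeight {m} {p} t with m ≤? m
  ... | yes _   = subst (λ d → p ∈ atDepth t d) (sym (n∸n≡0 m)) (here refl)
  ... | no  m≰m = contradiction ≤-refl m≰m

  atHeight-layered : ∀ {m p} (t : Bal m p) → Layered (atHeight t)
  atHeight-layered {m} t = record { ground-BB = atDepth-BB t ; built = builtFrom }
    where
      builtFrom : ∀ i {z} → z ∈ atHeight t (suc i) → ProductOf (_∈ atHeight t i) z
      builtFrom i {z} z∈ with suc i ≤? m | i ≤? m
      ... | yes i<m | yes _   =
        subst (λ d → ProductOf (_∈ atDepth t d) z) (sym (+-∸-assoc 1 i<m))
          (atDepth-built t (subst (_≤ m) (+-∸-assoc 1 i<m) (m∸n≤m m i)) z∈)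
      ... | yes i<m | no  i≰m = contradiction (<⇒≤ i<m) i≰m
      builtFrom i () | no _ | _

  atHeight-graded : ∀ {m p} (t : Bal m p) → size p ≡ 2 ^ m → Graded (atHeight t)
  atHeight-graded {m} t p-tight i with i ≤? m
  ... | yes i≤m = λ z∈ → trans (atDepth-size t p-tight {m ∸ i} z∈) (cong (2 ^_) (m∸[m∸n]≡n i≤m))
  ... | no  _   = λ ()

  -- Nest (n₂ ∷ ⋯ ∷ n_H) q o : o ∈ {P_H} ∘ (⋯ ∘ ({P₂} ∘ {q}) ⋯), Pⱼ balanced of height nⱼ.
  -- Unlike NestFrom, it is built from the innermost product outwards.
  data Nest : List ℕ → Carrier → Carrier → Set where
    []   : ∀ {q} → Nest [] q q
    wrap : ∀ {n ns p q z o} → Bal n p → op p q z → Nest ns z o → Nest (n ∷ ns) q o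

  NestFrom⇒Nest : ∀ {X} ns {o} → NestFrom X ns o → Σ Carrier λ q → X q × Nest ns q o
  NestFrom⇒Nest []       {o} xo = o , xo , []
  NestFrom⇒Nest (_ ∷ ns) nest with NestFrom⇒Nest ns nest
  ... | z , (p , q , t , xq , pq↦z) , N = q , xq , wrap t pq↦z N

  roots : ∀ {ns q o} → Nest ns q o → List Carrier
  roots []                 = []
  roots (wrap {p = p} _ _ N) = p ∷ roots N

  nestAtHeight : ∀ {ns q o} → Nest ns q o → ℕ → List Carrier
  nestAtHeight []           _ = []
  nestAtHeight (wrap t _ N) i = atHeight t i ++ nestAtHeight N i

  length-nestAtHeight : ∀ {ns q o} (N : Nest ns q o) i →
                     length (nestAtHeight N i) ≡ sum (map (λ n → floorPow2 n i) ns)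
  length-nestAtHeight []           i = refl
  length-nestAtHeight (wrap t _ N) i =
    trans (length-++ (atHeight t i)) (cong₂ _+_ (length-atHeight t i) (length-nestAtHeight N i))

  nestAtHeight-layered : ∀ {ns q o} (N : Nest ns q o) → Layered (nestAtHeight N)
  nestAtHeight-layered []           = Layered-[]
  nestAtHeight-layered (wrap t _ N) = Layered-++ (atHeight-layered t) (nestAtHeight-layered N)

  Nest-size-≤ : ∀ {ns q o} → Nest ns q o → size o ≤ size q + sum (map (2 ^_) ns)
  Nest-size-≤ {q = q} [] = m≤m+n (size q) 0
  Nest-size-≤ (wrap {n} {ns} {p} {q} {z} {o} t pq↦z N) = begin
    size o                    ≤⟨ Nest-size-≤ N ⟩
    size z + S                ≤⟨ +-monoˡ-≤ S (size-subadditive pq↦z) ⟩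
    size p + size q + S       ≤⟨ +-monoˡ-≤ S (+-monoˡ-≤ (size q) (Bal-size-≤ t)) ⟩
    2 ^ n + size q + S        ≡⟨ +-assoc (2 ^ n) (size q) S ⟩
    2 ^ n + (size q + S)      ≡⟨ x∙yz≈y∙xz (2 ^ n) (size q) S ⟩
    size q + (2 ^ n + S)      ∎
    where
      open ≤-Reasoning
      S : ℕ
      S = sum (map (2 ^_) ns)

  nestAtHeight-graded : ∀ {ns q o} (N : Nest ns q o) → size q + sum (map (2 ^_) ns) ≤ size o →
                        Graded (nestAtHeight N)
  nestAtHeight-graded [] _ _ ()
  nestAtHeight-graded (wrap {n} {ns} {p} {q} {z} {o} t pq↦z N) lower =
    Graded-++ (atHeight-graded t p-tight) (nestAtHeight-graded N z-lower)
    where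
      open ≤-Reasoning
      S : ℕ
      S = sum (map (2 ^_) ns)
      z-upper : size z + S ≤ size p + (size q + S)
      z-upper = begin
        size z + S            ≤⟨ +-monoˡ-≤ S (size-subadditive pq↦z) ⟩
        size p + size q + S   ≡⟨ +-assoc (size p) (size q) S ⟩
        size p + (size q + S) ∎
      p-tight : size p ≡ 2 ^ n
      p-tight = ≤-antisym (Bal-size-≤ t) (+-cancelʳ-≤ (size q + S) _ _ (begin
        2 ^ n + (size q + S)  ≡⟨ x∙yz≈y∙xz (2 ^ n) (size q) S ⟩
        size q + (2 ^ n + S)  ≤⟨ lower ⟩
        size o                ≤⟨ Nest-size-≤ N ⟩
        size z + S            ≤⟨ z-upper ⟩
        size p + (size q + S) ∎))
      z-lower : size z + S ≤ size o
      z-lower = begin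
        size z + S            ≤⟨ z-upper ⟩
        size p + (size q + S) ≡⟨ cong (_+ (size q + S)) p-tight ⟩
        2 ^ n + (size q + S)  ≡⟨ x∙yz≈y∙xz (2 ^ n) (size q) S ⟩
        size q + (2 ^ n + S)  ≤⟨ lower ⟩
        size o                ∎

  roots-available : ∀ {ns q o k} {X : Carrier → Set} (N : Nest ns q o) → All (_≤ k) ns →
                    (∀ {i} → i ≤ k → ∀ {z} → z ∈ nestAtHeight N i → X z) → All X (roots N)
  roots-available []           []            _     = []
  roots-available (wrap t _ N) (n≤k ∷ ns≤k) avail =
    avail n≤k (xs⊆xs++ys _ _ (root∈atHeight t)) ∷
    roots-available N ns≤k (λ {i} i≤k → avail i≤k ∘ xs⊆ys++xs _ (atHeight t i))

  Nest-chain : ∀ {ns q o C} (N : Nest ns q o) → Chain C → Avail C q → All (Avail C) (roots N) →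
    Σ (List Carrier) λ C′ → Chain C′ × Avail C′ o × length C′ ≡ length ns + length C
  Nest-chain []              ch q-av _ = _ , ch , q-av , refl
  Nest-chain (wrap t pq↦z N) ch q-av (p-av ∷ roots-av)
    with Nest-chain N (cons ch p-av q-av pq↦z) (inj₂ (here refl))
                      (All.map (Avail-mono there) roots-av)
  ... | C′ , ch′ , o-av , C′-len = C′ , ch′ , o-av , trans C′-len (+-suc _ _)

  representatives : ∀ {k} m → CardIs A k m → (xs : List Carrier) → All (λ z → size z ≡ k) xs →
                    Representatives xs (minCard (length xs) m)
  representatives nothing  _    xs _     = xs , ⊆-refl , ⊆-refl , ≤-refl
  representatives {k} (just c) enum xs sized =
    map proj₁ ys ,
    subst (map proj₁ ys ⊆_) toList≡xs (map⁺ proj₁ (∈-deduplicate⁻ _≟ₖ_ sizedList)) ,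
    subst (_⊆ map proj₁ ys) toList≡xs (map⁺ proj₁ (∈-deduplicate⁺ _≟ₖ_)) ,
    subst (_≤ length xs ⊓ c) (sym (length-map proj₁ ys))
      (⊓-glb length-ys≤xs (Unique⇒length≤ encode (deduplicate-! _≟ₖ_ sizedList)))
    where
      encode : SizeClass A k ↣ Fin c
      encode = ↔⇒↣ (↔-sym enum)
      _≟ₖ_ : DecidableEquality (SizeClass A k)
      _≟ₖ_ = inj⇒≟ encode
      sizedList : List (SizeClass A k)
      sizedList = All.toList sized
      ys : List (SizeClass A k)
      ys = deduplicate _≟ₖ_ sizedList
      toList≡xs : map proj₁ sizedList ≡ xs
      toList≡xs = map-proj₁-toList sized
      length-ys≤xs : length ys ≤ length xs
      length-ys≤xs = begin
        length ys                     ≤⟨ length-deduplicate _≟ₖ_ sizedList ⟩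
        length sizedList              ≡⟨ sym (length-map proj₁ sizedList) ⟩
        length (map proj₁ sizedList)  ≡⟨ cong length toList≡xs ⟩
        length xs                     ∎
        where open ≤-Reasoning

  forestAtHeight : ∀ {n₁ ns q o} → Bal n₁ q → Nest ns q o → ℕ → List Carrier
  forestAtHeight t N i = atHeight t i ++ nestAtHeight N i

  forest-graded : ∀ {n₁ ns q o} (t : Bal n₁ q) (N : Nest ns q o) →
                  2 ^ n₁ + sum (map (2 ^_) ns) ≡ size o → Graded (forestAtHeight t N)
  forest-graded {n₁} {ns} {q} {o} t N size-o =
    Graded-++ (atHeight-graded t q-tight) (nestAtHeight-graded N N-lower)
    where
      open ≤-Reasoning
      S : ℕ
      S = sum (map (2 ^_) ns)
      q-tight : size q ≡ 2 ^ n₁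
      q-tight = ≤-antisym (Bal-size-≤ t) (+-cancelʳ-≤ S _ _ (begin
        2 ^ n₁ + S   ≡⟨ size-o ⟩
        size o       ≤⟨ Nest-size-≤ N ⟩
        size q + S   ∎))
      N-lower : size q + S ≤ size o
      N-lower = begin
        size q + S   ≡⟨ cong (_+ S) q-tight ⟩
        2 ^ n₁ + S   ≡⟨ size-o ⟩
        size o       ∎

  decomposition-AAC : ∀ {n₁ ns q o} (card : ℕ → Maybe ℕ) → (∀ i → CardIs A (2 ^ i) (card i)) →
                      (t : Bal n₁ q) (N : Nest ns q o) → All (_≤ n₁) ns →
                      2 ^ n₁ + sum (map (2 ^_) ns) ≡ size o → BB o ⊎ AACWithin o (G (n₁ ∷ ns) card)
  decomposition-AAC {n₁} {ns} card card-spec t N ns≤n₁ size-o =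
    let C , ch , avail , C-len = layeredChain layered count reps n₁
        roots-av : All (Avail C) (roots N)
        roots-av = roots-available N ns≤n₁ (λ {i} i≤n₁ → avail i≤n₁ ∘ xs⊆ys++xs _ (atHeight t i))
        root-av : Avail C _
        root-av = avail ≤-refl (xs⊆xs++ys _ _ (root∈atHeight t))
        C′ , ch′ , o-av , C′-len = Nest-chain N ch root-av roots-av
    in Sum.map₂ (AACWithin-mono (≤-trans (≤-reflexive C′-len) (+-monoʳ-≤ (length ns) C-len))
                 ∘ flip Chain-∈⇒AACWithin ch′)
                o-av
    where
      L : ℕ → List Carrier
      L = forestAtHeight t N
      layered : Layered L
      layered = Layered-++ (atHeight-layered t) (nestAtHeight-layered N)
      count : ℕ → ℕ
      count i = minCard (sum (map (λ n → floorPow2 n i) (n₁ ∷ ns))) (card i)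
      length-L : ∀ i → length (L i) ≡ sum (map (λ n → floorPow2 n i) (n₁ ∷ ns))
      length-L i =
        trans (length-++ (atHeight t i)) (cong₂ _+_ (length-atHeight t i) (length-nestAtHeight N i))
      reps : ∀ i → Representatives (L i) (count i)
      reps i = subst (λ n → Representatives (L i) (minCard n (card i))) (length-L i)
                 (representatives (card i) (card-spec i) (L i)
                   (All.tabulate (forest-graded t N size-o i)))

  -- BB is not decidable in general, but a binary decomposable object is a block only if it is a
  -- single leaf: every other decomposition has size at least 2.
  BinDec-BB? : ∀ {n₁ ns o} → sum (map (2 ^_) (n₁ ∷ ns)) ≡ size o → BinDecWith n₁ ns o → Dec (BB o)
  BinDec-BB? {zero}  {[]}     _      (leaf bb) = yes bb
  BinDec-BB? {zero}  {n ∷ ns} size-o _         =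
    no (size≥2⇒¬BB (subst (2 ≤_) size-o (s≤s (≤-trans (m^n>0 2 n) (m≤m+n _ _)))))
  BinDec-BB? {suc k}          size-o _         =
    no (size≥2⇒¬BB (subst (2 ≤_) size-o (≤-trans (^-monoʳ-≤ 2 (s≤s (z≤n {k}))) (m≤m+n _ _))))

  assemblyIndex-≤ : ∀ {o m} → BB o ⊎ AACWithin o m → ∀ k → IsAssemblyIndex A o k → k ≤ m
  assemblyIndex-≤ _                     _ (inj₁ (_ , refl))        = z≤n
  assemblyIndex-≤ (inj₁ bb)             _ (inj₂ (¬bb , _))         = contradiction bb ¬bb
  assemblyIndex-≤ (inj₂ (r , aac , r≤m)) _ (inj₂ (_ , _ , minimal)) = ≤-trans (minimal r aac) r≤m

corollary1 : (A : AssemblySpace) →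
    let open AssemblySpace A in
    (card : ℕ → Maybe ℕ) → (∀ i → CardIs A (2 ^ i) (card i)) →
    (o : Carrier) (n₁ : ℕ) (ns : List ℕ) →
    Linked _>_ (n₁ ∷ ns) →
    sum (map (2 ^_) (n₁ ∷ ns)) ≡ size o →
    BinDecWith n₁ ns o →
    let Ma = (size o ∸ 1) ⊓ G (n₁ ∷ ns) card in
    ((∀ k → IsAssemblyIndex A o k → k ≤ Ma)
      × (BB o ⊎ Σ ℕ (λ r → AAC o r × r ≤ Ma)))
    × Ma ≤ size o ∸ 1
corollary1 A card card-spec o n₁ ns ordered size-o binDec =
  (assemblyIndex-≤ A within , within) , m⊓n≤m _ _
  where
    open AssemblySpace A
    within : BB o ⊎ AACWithin A o ((size o ∸ 1) ⊓ G (n₁ ∷ ns) card)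
    within with BinDec-BB? A {n₁} {ns} size-o binDec
    ... | yes bb  = inj₁ bb
    ... | no  ¬bb =
      let q , t , N = NestFrom⇒Nest A ns binDec
          decomposed = decomposition-AAC A card card-spec t N (linked>⇒All≤ ordered) size-o
          linear = _ , ¬BB⇒AAC-size A ¬bb , ≤-refl
      in inj₂ (AACWithin-⊓ A linear (Sum.[ flip contradiction ¬bb , id ] decomposed))
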